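{- Let $d \equiv 2 \pmod 4$ be a square-free integer such that both equations $x^2 - dy^2 = -1$ and $x^2 - dy^2 = 6$ are solvable in integers. Then in $\mathbb{Z}[\sqrt{d}]$ the following hold: (i) every element $x + y\sqrt{d}$ ($x, y \in \mathbb{Z}$) of norm $1$ satisfies $x \equiv \pm 1 \pmod 6$ and $y \equiv 0 \pmod 6$, and there are infinitely many such elements; (ii) every element $x + y\sqrt{d}$ of norm $-1$ satisfies $x \equiv 3 \pmod 6$ and $y \equiv \pm 1 \pmod 6$, and there are infinitely many such elements; (iii) $d \equiv 10 \pmod{48}$; (iv) every element $x + y\sqrt{d}$ of norm $6$ satisfies $x \equiv \pm 4 \pmod{12}$ and $y \equiv \pm 1 \pmod 6$, and there are infinitely many such elements; (v) every element $x + y\sqrt{d}$ of norm $-6$ satisfies $x \equiv \pm 2 \pmod{12}$ and $y \equiv \pm 1 \pmod 6$, and there are infinitely many such elements.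
   Context: The norm of $x + y\sqrt{d} \in \mathbb{Z}[\sqrt{d}]$ (with $x, y \in \mathbb{Z}$) is $(x + y\sqrt{d})(x - y\sqrt{d}) = x^2 - dy^2$. -}

module Defs where

open import Data.Integer using (ℤ; +_; -_; _-_; _*_; ∣_∣)
open import Data.Integer.Divisibility using (_∣_)
open import Data.Nat using (ℕ)
open import Data.Product using (_×_; ∃; Σ)
open import Data.List using (List)
open import Data.List.Membership.Propositional using (_∉_)
open import Relation.Binary.PropositionalEquality using (_≡_)

_≡_[mod_] : ℤ → ℤ → ℕ → Set
a ≡ b [mod m ] = (+ m) ∣ (a - b)

SquareFree : ℤ → Set
SquareFree d = ∀ (k : ℤ) → (k * k) ∣ d → ∣ k ∣ ≡ 1

N : ℤ → ℤ → ℤ → ℤ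
N d x y = x * x - d * (y * y)

Solvable : ℤ → ℤ → Set
Solvable d n = ∃ λ (x : ℤ) → ∃ λ (y : ℤ) → N d x y ≡ n

-- a set of elements x + y√d (identified with pairs (x , y)) is infinite:
-- it is not contained in any finite list
Infinite : (ℤ × ℤ → Set) → Set
Infinite P = ∀ (l : List (ℤ × ℤ)) → ∃ λ (p : ℤ × ℤ) → P p × p ∉ l

{-# OPTIONS --safe #-}
module Submission where

-- All congruences come from reducing a norm equation modulo a small number and running through
-- the residue classes. From x² − dy² = −1: 3 ∤ d and (with d ≡ 2 mod 4) d ≡ 2 mod 8; from
-- x² − dy² = 6 then: d ≡ 1 mod 3 and d ≡ 10 mod 16, so d ≡ 10 mod 48. Knowing d modulo 48, the
-- residues of x and y are read off modulo 12 (norms ±1), modulo 9 (3 ∤ xy for norms ±6) and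
-- modulo 16 (parities for norms ±6). The solution of norm −1 also rules out d < 0.
--
-- For infinitude, take x₁ + y₁√d of norm −1 (x₁, y₁ ≠ 0 by the congruences) and its square
-- ε = p + q√d, of norm 1 with p ≥ 2. Multiplying a solution with nonnegative coordinates by ε
-- keeps its norm and at least doubles x + y, so each norm ±1, ±6 has solutions of unbounded size,
-- hence not all in a finite list; norm −6 is obtained as (−1)·6, norm 1 as (−1)·(−1).

open import Defs
open import Data.Integer using (ℤ; +_; -_; _-_; _*_; _+_; ∣_∣; -[1+_])
import Data.Integer.Properties as ℤ
open import Data.Integer.DivMod using (_%_; _/_; a≡a%n+[a/n]*n; n%d<d)
import Data.Integer.Divisibility.Signed as ℤ∣
open import Data.Integer.Tactic.RingSolver using (solve-∀)
open import Data.Nat as ℕ using (ℕ; suc; _<_; _≤_; s≤s; z≤n)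
import Data.Nat.Properties as ℕ
open import Data.Nat.Divisibility as ℕ∣ using (divides; ∣-refl)
open import Data.Empty using (⊥-elim)
open import Data.List using (map)
open import Data.List.Extrema.Nat using (max; xs≤max)
open import Data.List.Membership.Propositional.Properties using (∈-map⁺)
import Data.List.Relation.Unary.All as All
open import Data.Product using (_×_; _,_; ∃; proj₁; proj₂)
import Data.Product as Product
open import Data.Sum using (_⊎_; inj₁; inj₂; [_,_]′)
import Data.Sum as Sum
open import Function using (_∘_)
open import Relation.Nullary using (Dec; ¬_)
open import Relation.Nullary.Decidable
  using (map′; True; False; toWitness; toWitnessFalse; ¬?; _→-dec_; _×-dec_; _⊎-dec_)
open import Relation.Binary.PropositionalEquality
  using (_≡_; _≢_; refl; sym; trans; cong; cong₂; module ≡-Reasoning)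

infix 4 _≡_⟨mod_⟩

-- `_≡_[mod_]` unfolds to a divisibility of ∣ a - b ∣, from which Agda cannot recover a and b;
-- the record makes them inferable.
record _≡_⟨mod_⟩ (a b : ℤ) (m : ℕ) : Set where
  constructor ⟨_⟩
  field unwrap : a ≡ b [mod m ]
open _≡_⟨mod_⟩

private
  variable
    a b c d x y d′ x′ y′ n : ℤ
    k m : ℕ

  fromSigned : (+ m) ℤ∣.∣ (a - b) → a ≡ b ⟨mod m ⟩
  fromSigned m∣a-b = ⟨ ℤ∣.∣⇒∣ᵤ m∣a-b ⟩

  toSigned : a ≡ b ⟨mod m ⟩ → (+ m) ℤ∣.∣ (a - b)
  toSigned ⟨ m∣a-b ⟩ = ℤ∣.∣ᵤ⇒∣ m∣a-b

  ∣-by : ∀ {i j} → i ≡ j → (+ m) ℤ∣.∣ i → (+ m) ℤ∣.∣ j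
  ∣-by refl m∣i = m∣i

unwrap-⊎ : a ≡ b ⟨mod m ⟩ ⊎ a ≡ c ⟨mod m ⟩ → a ≡ b [mod m ] ⊎ a ≡ c [mod m ]
unwrap-⊎ = Sum.map unwrap unwrap

≡-mod? : ∀ a b m → Dec (a ≡ b ⟨mod m ⟩)
≡-mod? a b m = map′ ⟨_⟩ unwrap (m ℕ∣.∣? ∣ a - b ∣)

≡-mod-refl : a ≡ a ⟨mod m ⟩
≡-mod-refl {a = a} = fromSigned (∣-by (sym (ℤ.+-inverseʳ a)) (ℤ∣.divides (+ 0) refl))

≡-mod-sym : a ≡ b ⟨mod m ⟩ → b ≡ a ⟨mod m ⟩
≡-mod-sym {a = a} {b = b} a≡b = fromSigned (∣-by (neg-diff a b) (ℤ∣.∣m⇒∣-m (toSigned a≡b)))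
  where
  neg-diff : ∀ a b → - (a - b) ≡ b - a
  neg-diff = solve-∀

≡-mod-trans : a ≡ b ⟨mod m ⟩ → b ≡ c ⟨mod m ⟩ → a ≡ c ⟨mod m ⟩
≡-mod-trans {a = a} {b = b} {c = c} a≡b b≡c =
  fromSigned (∣-by (telescope a b c) (ℤ∣.∣m∣n⇒∣m+n (toSigned a≡b) (toSigned b≡c)))
  where
  telescope : ∀ a b c → (a - b) + (b - c) ≡ a - c
  telescope = solve-∀

≡-mod-weaken : k ℕ∣.∣ m → a ≡ b ⟨mod m ⟩ → a ≡ b ⟨mod k ⟩
≡-mod-weaken k∣m ⟨ m∣a-b ⟩ = ⟨ ℕ∣.∣-trans k∣m m∣a-b ⟩

≡-mod-% : ∀ m .{{_ : ℕ.NonZero m}} a → a ≡ + (a % + m) ⟨mod m ⟩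
≡-mod-% m a = fromSigned (ℤ∣.divides (a / + m) (cancel (a≡a%n+[a/n]*n a (+ m))))
  where
  add-sub : ∀ r q → (r + q) - r ≡ q
  add-sub = solve-∀
  cancel : ∀ {a r q} → a ≡ r + q → a - r ≡ q
  cancel {r = r} {q} refl = add-sub r q

N-≡-mod : d ≡ d′ ⟨mod m ⟩ → x ≡ x′ ⟨mod m ⟩ → y ≡ y′ ⟨mod m ⟩ → N d x y ≡ N d′ x′ y′ ⟨mod m ⟩
N-≡-mod {d = d} {d′ = d′} {x = x} {x′ = x′} {y = y} {y′ = y′} d≡ x≡ y≡ =
  fromSigned (∣-by (expand d x y d′ x′ y′)
    (ℤ∣.∣m∣n⇒∣m-n (ℤ∣.∣m⇒∣m*n (x + x′) (toSigned x≡))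
      (ℤ∣.∣m∣n⇒∣m+n (ℤ∣.∣m⇒∣m*n (y * y) (toSigned d≡))
                    (ℤ∣.∣n⇒∣m*n d′ (ℤ∣.∣m⇒∣m*n (y + y′) (toSigned y≡))))))
  where
  expand : ∀ d x y d′ x′ y′
         → (x - x′) * (x + x′) - ((d - d′) * (y * y) + d′ * ((y - y′) * (y + y′)))
         ≡ (x * x - d * (y * y)) - (x′ * x′ - d′ * (y′ * y′))
  expand = solve-∀

nonzero-residue⇒1≤∣∣ : a ≡ c ⟨mod m ⟩ → {False (≡-mod? (+ 0) c m)} → 1 ≤ ∣ a ∣
nonzero-residue⇒1≤∣∣ {a = + 0} 0≡c {0≢c} = ⊥-elim (toWitnessFalse 0≢c 0≡c)
nonzero-residue⇒1≤∣∣ {a = + suc _} _ = s≤s z≤n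
nonzero-residue⇒1≤∣∣ {a = -[1+ _ ]} _ = s≤s z≤n

-- The implicit argument has type ⊤ exactly when the decision procedure evaluates to `yes`, so
-- Agda fills it in by running the exhaustive check over all residues during type checking.
decide : ∀ m {P : ℕ → Set} (P? : ∀ r → Dec (P r)) → {True (ℕ.allUpTo? P? m)}
       → ∀ {r} → r < m → P r
decide m P? {all} = toWitness all

decide₂ : ∀ m {P : ℕ → ℕ → Set} (P? : ∀ r s → Dec (P r s))
        → {True (ℕ.allUpTo? (λ r → ℕ.allUpTo? (P? r) m) m)}
        → ∀ {r} → r < m → ∀ {s} → s < m → P r s
decide₂ m P? {all} = decide m (λ r → ℕ.allUpTo? (P? r) m) {all}

decide₃ : ∀ m {P : ℕ → ℕ → ℕ → Set} (P? : ∀ r s t → Dec (P r s t))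
        → {True (ℕ.allUpTo? (λ r → ℕ.allUpTo? (λ s → ℕ.allUpTo? (P? r s) m) m) m)}
        → ∀ {r} → r < m → ∀ {s} → s < m → ∀ {t} → t < m → P r s t
decide₃ m P? {all} = decide₂ m (λ r s → ℕ.allUpTo? (P? r s) m) {all}

module Residues (m : ℕ) .{{_ : ℕ.NonZero m}} where

  res : ℤ → ℤ
  res a = + (a % + m)

  res<m : ∀ a → a % + m < m
  res<m a = n%d<d a (+ m)

  to-res : k ℕ∣.∣ m → a ≡ c ⟨mod k ⟩ → res a ≡ c ⟨mod k ⟩
  to-res {a = a} k∣m = ≡-mod-trans (≡-mod-weaken k∣m (≡-mod-sym (≡-mod-% m a)))

  from-res : k ℕ∣.∣ m → res a ≡ c ⟨mod k ⟩ → a ≡ c ⟨mod k ⟩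
  from-res {a = a} k∣m = ≡-mod-trans (≡-mod-weaken k∣m (≡-mod-% m a))

  from-res-⊎ : k ℕ∣.∣ m → res a ≡ b ⟨mod k ⟩ ⊎ res a ≡ c ⟨mod k ⟩ → a ≡ b ⟨mod k ⟩ ⊎ a ≡ c ⟨mod k ⟩
  from-res-⊎ k∣m = Sum.map (from-res k∣m) (from-res k∣m)

  N-res : ∀ d′ x y → d ≡ d′ ⟨mod m ⟩ → N d x y ≡ n → N (res d′) (res x) (res y) ≡ n ⟨mod m ⟩
  N-res d′ x y d≡d′ refl =
    ≡-mod-sym (N-≡-mod (≡-mod-trans d≡d′ (≡-mod-% m d′)) (≡-mod-% m x) (≡-mod-% m y))

N≡-1⇒d≢0-mod3 : ∀ x y → N d x y ≡ - + 1 → ¬ d ≡ + 0 ⟨mod 3 ⟩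
N≡-1⇒d≢0-mod3 {d} x y N≡-1 d≡0 =
  decide₃ 3 (λ rd rx ry → ≡-mod? (N (+ rd) (+ rx) (+ ry)) (- + 1) 3
                          →-dec ¬? (≡-mod? (+ rd) (+ 0) 3))
    (res<m d) (res<m x) (res<m y) (N-res d x y ≡-mod-refl N≡-1) (to-res ∣-refl d≡0)
  where open Residues 3

N≡6⇒d≡1-mod3 : ¬ d ≡ + 0 ⟨mod 3 ⟩ → ∀ x y → N d x y ≡ + 6 → d ≡ + 1 ⟨mod 3 ⟩
N≡6⇒d≡1-mod3 {d} d≢0 x y N≡6 = from-res (divides 3 refl)
  (decide₃ 9 (λ rd rx ry → ¬? (≡-mod? (+ rd) (+ 0) 3)
                           →-dec ≡-mod? (N (+ rd) (+ rx) (+ ry)) (+ 6) 9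
                           →-dec ≡-mod? (+ rd) (+ 1) 3)
    (res<m d) (res<m x) (res<m y) (d≢0 ∘ from-res (divides 3 refl)) (N-res d x y ≡-mod-refl N≡6))
  where open Residues 9

N≡-1⇒d≡2-mod8 : d ≡ + 2 ⟨mod 4 ⟩ → ∀ x y → N d x y ≡ - + 1 → d ≡ + 2 ⟨mod 8 ⟩
N≡-1⇒d≡2-mod8 {d} d≡2 x y N≡-1 = from-res ∣-refl
  (decide₃ 8 (λ rd rx ry → ≡-mod? (+ rd) (+ 2) 4
                           →-dec ≡-mod? (N (+ rd) (+ rx) (+ ry)) (- + 1) 8
                           →-dec ≡-mod? (+ rd) (+ 2) 8)
    (res<m d) (res<m x) (res<m y) (to-res (divides 2 refl) d≡2) (N-res d x y ≡-mod-refl N≡-1))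
  where open Residues 8

N≡6⇒d≡10-mod16 : d ≡ + 2 ⟨mod 8 ⟩ → ∀ x y → N d x y ≡ + 6 → d ≡ + 10 ⟨mod 16 ⟩
N≡6⇒d≡10-mod16 {d} d≡2 x y N≡6 = from-res ∣-refl
  (decide₃ 16 (λ rd rx ry → ≡-mod? (+ rd) (+ 2) 8
                            →-dec ≡-mod? (N (+ rd) (+ rx) (+ ry)) (+ 6) 16
                            →-dec ≡-mod? (+ rd) (+ 10) 16)
    (res<m d) (res<m x) (res<m y) (to-res (divides 2 refl) d≡2) (N-res d x y ≡-mod-refl N≡6))
  where open Residues 16

≡1-mod3∧≡10-mod16⇒≡10-mod48 : a ≡ + 1 ⟨mod 3 ⟩ → a ≡ + 10 ⟨mod 16 ⟩ → a ≡ + 10 ⟨mod 48 ⟩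
≡1-mod3∧≡10-mod16⇒≡10-mod48 {a} a≡1 a≡10 = from-res ∣-refl
  (decide 48 (λ r → ≡-mod? (+ r) (+ 1) 3 →-dec ≡-mod? (+ r) (+ 10) 16 →-dec ≡-mod? (+ r) (+ 10) 48)
    (res<m a) (to-res (divides 16 refl) a≡1) (to-res (divides 3 refl) a≡10))
  where open Residues 48

≡10-mod48⇒≡1-mod3 : a ≡ + 10 ⟨mod 48 ⟩ → a ≡ + 1 ⟨mod 3 ⟩
≡10-mod48⇒≡1-mod3 a≡10 = ≡-mod-trans (≡-mod-weaken (divides 16 refl) a≡10) ⟨ divides 3 refl ⟩

d≡10-mod48 : d ≡ + 2 ⟨mod 4 ⟩ → Solvable d (- + 1) → Solvable d (+ 6) → d ≡ + 10 ⟨mod 48 ⟩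
d≡10-mod48 d≡2 (x₁ , y₁ , N≡-1) (x₆ , y₆ , N≡6) = ≡1-mod3∧≡10-mod16⇒≡10-mod48
  (N≡6⇒d≡1-mod3 (N≡-1⇒d≢0-mod3 x₁ y₁ N≡-1) x₆ y₆ N≡6)
  (N≡6⇒d≡10-mod16 (N≡-1⇒d≡2-mod8 d≡2 x₁ y₁ N≡-1) x₆ y₆ N≡6)

N≡1⇒x≡±1∧y≡0-mod6 : d ≡ + 10 ⟨mod 12 ⟩ → ∀ x y → N d x y ≡ + 1
                   → (x ≡ + 1 ⟨mod 6 ⟩ ⊎ x ≡ - + 1 ⟨mod 6 ⟩) × y ≡ + 0 ⟨mod 6 ⟩
N≡1⇒x≡±1∧y≡0-mod6 d≡10 x y N≡1 =
  Product.map (from-res-⊎ (divides 2 refl)) (from-res (divides 2 refl))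
    (decide₂ 12 (λ rx ry → ≡-mod? (N (+ 10) (+ rx) (+ ry)) (+ 1) 12
                           →-dec (≡-mod? (+ rx) (+ 1) 6 ⊎-dec ≡-mod? (+ rx) (- + 1) 6)
                                 ×-dec ≡-mod? (+ ry) (+ 0) 6)
      (res<m x) (res<m y) (N-res (+ 10) x y d≡10 N≡1))
  where open Residues 12

N≡-1⇒x≡3∧y≡±1-mod6 : d ≡ + 10 ⟨mod 12 ⟩ → ∀ x y → N d x y ≡ - + 1
                    → x ≡ + 3 ⟨mod 6 ⟩ × (y ≡ + 1 ⟨mod 6 ⟩ ⊎ y ≡ - + 1 ⟨mod 6 ⟩)
N≡-1⇒x≡3∧y≡±1-mod6 d≡10 x y N≡-1 =
  Product.map (from-res (divides 2 refl)) (from-res-⊎ (divides 2 refl))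
    (decide₂ 12 (λ rx ry → ≡-mod? (N (+ 10) (+ rx) (+ ry)) (- + 1) 12
                           →-dec ≡-mod? (+ rx) (+ 3) 6
                                 ×-dec (≡-mod? (+ ry) (+ 1) 6 ⊎-dec ≡-mod? (+ ry) (- + 1) 6))
      (res<m x) (res<m y) (N-res (+ 10) x y d≡10 N≡-1))
  where open Residues 12

N≡±6⇒x≢0∧y≢0-mod3 : d ≡ + 1 ⟨mod 3 ⟩ → ∀ x y → N d x y ≡ + 6 ⊎ N d x y ≡ - + 6
                   → ¬ x ≡ + 0 ⟨mod 3 ⟩ × ¬ y ≡ + 0 ⟨mod 3 ⟩
N≡±6⇒x≢0∧y≢0-mod3 {d} d≡1 x y N≡±6 =
  Product.map (_∘ to-res (divides 3 refl)) (_∘ to-res (divides 3 refl))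
    (decide₃ 9 (λ rd rx ry → ≡-mod? (+ rd) (+ 1) 3
                             →-dec (≡-mod? (N (+ rd) (+ rx) (+ ry)) (+ 6) 9
                                    ⊎-dec ≡-mod? (N (+ rd) (+ rx) (+ ry)) (- + 6) 9)
                             →-dec ¬? (≡-mod? (+ rx) (+ 0) 3) ×-dec ¬? (≡-mod? (+ ry) (+ 0) 3))
      (res<m d) (res<m x) (res<m y) (to-res (divides 3 refl) d≡1)
      (Sum.map (N-res d x y ≡-mod-refl) (N-res d x y ≡-mod-refl) N≡±6))
  where open Residues 9

N≡6⇒x≡0-mod4∧y≡1-mod2 : d ≡ + 10 ⟨mod 16 ⟩ → ∀ x y → N d x y ≡ + 6
                       → x ≡ + 0 ⟨mod 4 ⟩ × y ≡ + 1 ⟨mod 2 ⟩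
N≡6⇒x≡0-mod4∧y≡1-mod2 d≡10 x y N≡6 =
  Product.map (from-res (divides 4 refl)) (from-res (divides 8 refl))
    (decide₂ 16 (λ rx ry → ≡-mod? (N (+ 10) (+ rx) (+ ry)) (+ 6) 16
                           →-dec ≡-mod? (+ rx) (+ 0) 4 ×-dec ≡-mod? (+ ry) (+ 1) 2)
      (res<m x) (res<m y) (N-res (+ 10) x y d≡10 N≡6))
  where open Residues 16

N≡-6⇒x≡2-mod4∧y≡1-mod2 : d ≡ + 10 ⟨mod 16 ⟩ → ∀ x y → N d x y ≡ - + 6
                        → x ≡ + 2 ⟨mod 4 ⟩ × y ≡ + 1 ⟨mod 2 ⟩
N≡-6⇒x≡2-mod4∧y≡1-mod2 d≡10 x y N≡-6 =
  Product.map (from-res (divides 4 refl)) (from-res (divides 8 refl))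
    (decide₂ 16 (λ rx ry → ≡-mod? (N (+ 10) (+ rx) (+ ry)) (- + 6) 16
                           →-dec ≡-mod? (+ rx) (+ 2) 4 ×-dec ≡-mod? (+ ry) (+ 1) 2)
      (res<m x) (res<m y) (N-res (+ 10) x y d≡10 N≡-6))
  where open Residues 16

≢0-mod3∧≡0-mod4⇒≡±4-mod12 : ¬ a ≡ + 0 ⟨mod 3 ⟩ → a ≡ + 0 ⟨mod 4 ⟩
                          → a ≡ + 4 ⟨mod 12 ⟩ ⊎ a ≡ - + 4 ⟨mod 12 ⟩
≢0-mod3∧≡0-mod4⇒≡±4-mod12 {a} a≢0 a≡0 = from-res-⊎ ∣-refl
  (decide 12 (λ r → ¬? (≡-mod? (+ r) (+ 0) 3) →-dec ≡-mod? (+ r) (+ 0) 4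
                     →-dec (≡-mod? (+ r) (+ 4) 12 ⊎-dec ≡-mod? (+ r) (- + 4) 12))
    (res<m a) (a≢0 ∘ from-res (divides 4 refl)) (to-res (divides 3 refl) a≡0))
  where open Residues 12

≢0-mod3∧≡2-mod4⇒≡±2-mod12 : ¬ a ≡ + 0 ⟨mod 3 ⟩ → a ≡ + 2 ⟨mod 4 ⟩
                          → a ≡ + 2 ⟨mod 12 ⟩ ⊎ a ≡ - + 2 ⟨mod 12 ⟩
≢0-mod3∧≡2-mod4⇒≡±2-mod12 {a} a≢0 a≡2 = from-res-⊎ ∣-refl
  (decide 12 (λ r → ¬? (≡-mod? (+ r) (+ 0) 3) →-dec ≡-mod? (+ r) (+ 2) 4
                     →-dec (≡-mod? (+ r) (+ 2) 12 ⊎-dec ≡-mod? (+ r) (- + 2) 12))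
    (res<m a) (a≢0 ∘ from-res (divides 4 refl)) (to-res (divides 3 refl) a≡2))
  where open Residues 12

≢0-mod3∧≡1-mod2⇒≡±1-mod6 : ¬ a ≡ + 0 ⟨mod 3 ⟩ → a ≡ + 1 ⟨mod 2 ⟩
                         → a ≡ + 1 ⟨mod 6 ⟩ ⊎ a ≡ - + 1 ⟨mod 6 ⟩
≢0-mod3∧≡1-mod2⇒≡±1-mod6 {a} a≢0 a≡1 = from-res-⊎ ∣-refl
  (decide 6 (λ r → ¬? (≡-mod? (+ r) (+ 0) 3) →-dec ≡-mod? (+ r) (+ 1) 2
                    →-dec (≡-mod? (+ r) (+ 1) 6 ⊎-dec ≡-mod? (+ r) (- + 1) 6))
    (res<m a) (a≢0 ∘ from-res (divides 2 refl)) (to-res (divides 3 refl) a≡1))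
  where open Residues 6

N≡6⇒x≡±4-mod12∧y≡±1-mod6 : d ≡ + 10 ⟨mod 48 ⟩ → ∀ x y → N d x y ≡ + 6
                          → (x ≡ + 4 ⟨mod 12 ⟩ ⊎ x ≡ - + 4 ⟨mod 12 ⟩)
                            × (y ≡ + 1 ⟨mod 6 ⟩ ⊎ y ≡ - + 1 ⟨mod 6 ⟩)
N≡6⇒x≡±4-mod12∧y≡±1-mod6 d≡10 x y N≡6 =
  Product.zip′ ≢0-mod3∧≡0-mod4⇒≡±4-mod12 ≢0-mod3∧≡1-mod2⇒≡±1-mod6
    (N≡±6⇒x≢0∧y≢0-mod3 (≡10-mod48⇒≡1-mod3 d≡10) x y (inj₁ N≡6))
    (N≡6⇒x≡0-mod4∧y≡1-mod2 (≡-mod-weaken (divides 3 refl) d≡10) x y N≡6)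

N≡-6⇒x≡±2-mod12∧y≡±1-mod6 : d ≡ + 10 ⟨mod 48 ⟩ → ∀ x y → N d x y ≡ - + 6
                           → (x ≡ + 2 ⟨mod 12 ⟩ ⊎ x ≡ - + 2 ⟨mod 12 ⟩)
                             × (y ≡ + 1 ⟨mod 6 ⟩ ⊎ y ≡ - + 1 ⟨mod 6 ⟩)
N≡-6⇒x≡±2-mod12∧y≡±1-mod6 d≡10 x y N≡-6 =
  Product.zip′ ≢0-mod3∧≡2-mod4⇒≡±2-mod12 ≢0-mod3∧≡1-mod2⇒≡±1-mod6
    (N≡±6⇒x≢0∧y≢0-mod3 (≡10-mod48⇒≡1-mod3 d≡10) x y (inj₂ N≡-6))
    (N≡-6⇒x≡2-mod4∧y≡1-mod2 (≡-mod-weaken (divides 3 refl) d≡10) x y N≡-6)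

N-* : ∀ d p q x y → N d (p * x + d * q * y) (q * x + p * y) ≡ N d p q * N d x y
N-* = expand
  where
  expand : ∀ d p q x y
         → (p * x + d * q * y) * (p * x + d * q * y) - d * ((q * x + p * y) * (q * x + p * y))
         ≡ (p * p - d * (q * q)) * (x * x - d * (y * y))
  expand = solve-∀

solvable-* : ∀ d → Solvable d a → Solvable d b → Solvable d (a * b)
solvable-* d (p , q , N≡a) (x , y , N≡b) =
  p * x + d * q * y , q * x + p * y , trans (N-* d p q x y) (cong₂ _*_ N≡a N≡b)

square-abs : ∀ x → x * x ≡ + (∣ x ∣ ℕ.* ∣ x ∣)
square-abs (+ n) = sym (ℤ.pos-* n n)
square-abs -[1+ n ] = refl

N-abs : ∀ d x y → N d x y ≡ N d (+ ∣ x ∣) (+ ∣ y ∣)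
N-abs d x y = cong₂ (λ u v → u - d * v) (trans (square-abs x) (sym (square-abs (+ ∣ x ∣))))
                                         (trans (square-abs y) (sym (square-abs (+ ∣ y ∣))))

N-negative : ∀ m x y → N -[1+ m ] x y ≡ + (∣ x ∣ ℕ.* ∣ x ∣ ℕ.+ suc m ℕ.* (∣ y ∣ ℕ.* ∣ y ∣))
N-negative m x y = begin
  N -[1+ m ] x y                                        ≡⟨ sub-neg x y (+ suc m) ⟩
  x * x + + suc m * (y * y)                             ≡⟨ cong₂ (λ u v → u + + suc m * v)
                                                                 (square-abs x) (square-abs y) ⟩
  + (∣ x ∣ ℕ.* ∣ x ∣) + + suc m * + (∣ y ∣ ℕ.* ∣ y ∣)    ≡⟨ cong (λ v → + (∣ x ∣ ℕ.* ∣ x ∣) + v)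
                                                                (sym (ℤ.pos-* (suc m) _)) ⟩
  + (∣ x ∣ ℕ.* ∣ x ∣) + + (suc m ℕ.* (∣ y ∣ ℕ.* ∣ y ∣))  ≡⟨ sym (ℤ.pos-+ (∣ x ∣ ℕ.* ∣ x ∣) _) ⟩
  + (∣ x ∣ ℕ.* ∣ x ∣ ℕ.+ suc m ℕ.* (∣ y ∣ ℕ.* ∣ y ∣))    ∎
  where
  open ≡-Reasoning
  sub-neg : ∀ x y e → x * x - (- e) * (y * y) ≡ x * x + e * (y * y)
  sub-neg = solve-∀

N-negative≢-1 : ∀ m x y → N -[1+ m ] x y ≢ - + 1
N-negative≢-1 m x y N≡-1 with trans (sym (N-negative m x y)) N≡-1
... | ()

normℕ : ℕ → ℕ × ℕ → ℤ
normℕ D (x , y) = N (+ D) (+ x) (+ y)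

mul√ : ℕ → ℕ × ℕ → ℕ × ℕ → ℕ × ℕ
mul√ D (p , q) (x , y) = p ℕ.* x ℕ.+ D ℕ.* q ℕ.* y , q ℕ.* x ℕ.+ p ℕ.* y

normℕ-mul√ : ∀ D s t → normℕ D (mul√ D s t) ≡ normℕ D s * normℕ D t
normℕ-mul√ D (p , q) (x , y) =
  trans (cong₂ (N (+ D)) first second) (N-* (+ D) (+ p) (+ q) (+ x) (+ y))
  where
  first : + (p ℕ.* x ℕ.+ D ℕ.* q ℕ.* y) ≡ + p * + x + + D * + q * + y
  first = trans (ℤ.pos-+ (p ℕ.* x) _)
                (cong₂ _+_ (ℤ.pos-* p x) (trans (ℤ.pos-* (D ℕ.* q) y) (cong (_* + y) (ℤ.pos-* D q))))
  second : + (q ℕ.* x ℕ.+ p ℕ.* y) ≡ + q * + x + + p * + y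
  second = trans (ℤ.pos-+ (q ℕ.* x) _) (cong₂ _+_ (ℤ.pos-* q x) (ℤ.pos-* p y))

size : ℕ × ℕ → ℕ
size (x , y) = x ℕ.+ y

size-mul√ : ∀ D {p q} s → 2 ≤ p → size s ℕ.+ size s ≤ size (mul√ D (p , q) s)
size-mul√ D {p} {q} (x , y) 2≤p = begin
  (x ℕ.+ y) ℕ.+ (x ℕ.+ y)                              ≡⟨ cong ((x ℕ.+ y) ℕ.+_) (sym (ℕ.+-identityʳ _)) ⟩
  2 ℕ.* (x ℕ.+ y)                                      ≤⟨ ℕ.*-monoˡ-≤ (x ℕ.+ y) 2≤p ⟩
  p ℕ.* (x ℕ.+ y)                                      ≡⟨ ℕ.*-distribˡ-+ p x y ⟩
  p ℕ.* x ℕ.+ p ℕ.* y                                  ≤⟨ ℕ.+-mono-≤ (ℕ.m≤m+n (p ℕ.* x) _)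
                                                                     (ℕ.m≤n+m (p ℕ.* y) _) ⟩
  (p ℕ.* x ℕ.+ D ℕ.* q ℕ.* y) ℕ.+ (q ℕ.* x ℕ.+ p ℕ.* y) ∎
  where open ℕ.≤-Reasoning

0<size : ∀ D s → normℕ D s ≢ + 0 → 0 < size s
0<size _ (suc _ , _) _ = s≤s z≤n
0<size _ (0 , suc _) _ = s≤s z≤n
0<size D (0 , 0) N≢0 = ⊥-elim (N≢0 (cong (λ v → + 0 - v) (ℤ.*-zeroʳ (+ D))))

orbit-unbounded : ∀ D ε → 2 ≤ proj₁ ε → normℕ D ε ≡ + 1
                → ∀ s → 0 < size s → ∀ B → ∃ λ t → normℕ D t ≡ normℕ D s × B < size t
orbit-unbounded D ε 2≤p Nε≡1 s 0<s = go
  where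
  go : ∀ B → ∃ λ t → normℕ D t ≡ normℕ D s × B < size t
  go 0 = s , refl , 0<s
  go (suc B) with go B
  ... | t , Nt≡Ns , B<t = mul√ D ε t , Nεt≡Ns ,
        ℕ.<-≤-trans (ℕ.+-mono-≤ (ℕ.≤-trans (s≤s z≤n) B<t) B<t) (size-mul√ D t 2≤p)
    where
    Nεt≡Ns : normℕ D (mul√ D ε t) ≡ normℕ D s
    Nεt≡Ns = trans (normℕ-mul√ D ε t) (trans (cong₂ _*_ Nε≡1 Nt≡Ns) (ℤ.*-identityˡ _))

sizeℤ : ℤ × ℤ → ℕ
sizeℤ (x , y) = ∣ x ∣ ℕ.+ ∣ y ∣

unbounded⇒infinite : {P : ℤ × ℤ → Set} → (∀ B → ∃ λ z → P z × B < sizeℤ z) → Infinite P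
unbounded⇒infinite unbounded l with unbounded (max 0 (map sizeℤ l))
... | z , Pz , max<z =
  z , Pz , λ z∈l → ℕ.<⇒≱ max<z (All.lookup (xs≤max 0 (map sizeℤ l)) (∈-map⁺ sizeℤ z∈l))

infinite-solutions : ∀ {D X Y} → 1 ≤ D → 1 ≤ X → 1 ≤ Y → normℕ D (X , Y) ≡ - + 1
                   → n ≢ + 0 → Solvable (+ D) n → Infinite (λ z → N (+ D) (proj₁ z) (proj₂ z) ≡ n)
infinite-solutions {D = D} {X} {Y} 1≤D 1≤X 1≤Y N≡-1 n≢0 (x , y , N≡n) = unbounded⇒infinite λ B →
  let t , Nt≡Ns , B<t = orbit-unbounded D ε 2≤p Nε≡1 s 0<s B
  in (+ proj₁ t , + proj₂ t) , trans Nt≡Ns Ns≡n , B<t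
  where
  ε = mul√ D (X , Y) (X , Y)
  2≤p : 2 ≤ proj₁ ε
  2≤p = ℕ.+-mono-≤ (ℕ.*-mono-≤ 1≤X 1≤X) (ℕ.*-mono-≤ (ℕ.*-mono-≤ 1≤D 1≤Y) 1≤Y)
  Nε≡1 : normℕ D ε ≡ + 1
  Nε≡1 = trans (normℕ-mul√ D (X , Y) (X , Y)) (cong₂ _*_ N≡-1 N≡-1)
  s = ∣ x ∣ , ∣ y ∣
  Ns≡n : normℕ D s ≡ _
  Ns≡n = trans (sym (N-abs (+ D) x y)) N≡n
  0<s : 0 < size s
  0<s = 0<size D s (n≢0 ∘ trans (sym Ns≡n))

lemma3p1 : (d : ℤ) → d ≡ + 2 [mod 4 ] → SquareFree d
           → Solvable d (- + 1) → Solvable d (+ 6)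
           → ((∀ x y → N d x y ≡ + 1
                 → (x ≡ + 1 [mod 6 ] ⊎ x ≡ - + 1 [mod 6 ]) × y ≡ + 0 [mod 6 ])
              × Infinite (λ { (x , y) → N d x y ≡ + 1 }))
           × ((∀ x y → N d x y ≡ - + 1
                 → x ≡ + 3 [mod 6 ] × (y ≡ + 1 [mod 6 ] ⊎ y ≡ - + 1 [mod 6 ]))
              × Infinite (λ { (x , y) → N d x y ≡ - + 1 }))
           × d ≡ + 10 [mod 48 ]
           × ((∀ x y → N d x y ≡ + 6
                 → (x ≡ + 4 [mod 12 ] ⊎ x ≡ - + 4 [mod 12 ])
                   × (y ≡ + 1 [mod 6 ] ⊎ y ≡ - + 1 [mod 6 ]))
              × Infinite (λ { (x , y) → N d x y ≡ + 6 }))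
           × ((∀ x y → N d x y ≡ - + 6
                 → (x ≡ + 2 [mod 12 ] ⊎ x ≡ - + 2 [mod 12 ])
                   × (y ≡ + 1 [mod 6 ] ⊎ y ≡ - + 1 [mod 6 ]))
              × Infinite (λ { (x , y) → N d x y ≡ - + 6 }))
lemma3p1 -[1+ m ] _ _ (x , y , N≡-1) _ = ⊥-elim (N-negative≢-1 m x y N≡-1)
lemma3p1 (+ D) d≡2 _ sol₋₁@(x₁ , y₁ , N₁≡-1) sol₆ =
    ((λ x y → Product.map unwrap-⊎ unwrap ∘ N≡1⇒x≡±1∧y≡0-mod6 d≡10-mod12 x y)
    , infinite (λ ()) (solvable-* (+ D) sol₋₁ sol₋₁))
  , ((λ x y → Product.map unwrap unwrap-⊎ ∘ N≡-1⇒x≡3∧y≡±1-mod6 d≡10-mod12 x y)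
    , infinite (λ ()) sol₋₁)
  , unwrap d≡10
  , ((λ x y → Product.map unwrap-⊎ unwrap-⊎ ∘ N≡6⇒x≡±4-mod12∧y≡±1-mod6 d≡10 x y)
    , infinite (λ ()) sol₆)
  , ((λ x y → Product.map unwrap-⊎ unwrap-⊎ ∘ N≡-6⇒x≡±2-mod12∧y≡±1-mod6 d≡10 x y)
    , infinite (λ ()) (solvable-* (+ D) sol₋₁ sol₆))
  where
  d≡10 : + D ≡ + 10 ⟨mod 48 ⟩
  d≡10 = d≡10-mod48 ⟨ d≡2 ⟩ sol₋₁ sol₆
  d≡10-mod12 : + D ≡ + 10 ⟨mod 12 ⟩
  d≡10-mod12 = ≡-mod-weaken (divides 4 refl) d≡10
  infinite : n ≢ + 0 → Solvable (+ D) n → Infinite (λ z → N (+ D) (proj₁ z) (proj₂ z) ≡ n)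
  infinite =
    let x₁≡3 , y₁≡±1 = N≡-1⇒x≡3∧y≡±1-mod6 d≡10-mod12 x₁ y₁ N₁≡-1
    in infinite-solutions (nonzero-residue⇒1≤∣∣ d≡10) (nonzero-residue⇒1≤∣∣ x₁≡3)
                          ([ nonzero-residue⇒1≤∣∣ , nonzero-residue⇒1≤∣∣ ]′ y₁≡±1)
                          (trans (sym (N-abs (+ D) x₁ y₁)) N₁≡-1)
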